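{- Let $r\ge2$, let $p_1,\dots,p_r$ be constants with $p_r\ne0$, let $(\tilde F^{(r)}_n)_{n\ge0}$ be the impulse response sequence with respect to $\{p_1,\dots,p_r\}$, and let $(a_n)_{n\in\mathbb Z}$ be a sequence satisfying $a_n=\sum_{j=1}^rp_ja_{n-j}$ for all integers $n$ (i.e. a sequence satisfying the recurrence for $n\ge r$, extended uniquely to negative indices using the recurrence, which is possible since $p_r\neq0$). Let $\mathbf e_r=(0,\dots,0,1)^T\in\mathbb R^r$. (i) If $r$ is even, suppose $\mathbf c=(c_{r/2},c_{r/2+1},\dots,c_{r-1},c_r,c_{r+1},\dots,c_{3r/2-1})^T$ satisfies $A_e\mathbf c=\mathbf e_r$, where $A_e$ is the $r\times r$ matrix whose row indexed by $n=0,1,\dots,r-1$ is $$\left(a_{n+r/2},a_{n+r/2-1},\dots,a_{n+1},\ a_{n-1},a_{n-2},\dots,a_{n-r/2}\right)$$ (so the first row is $(a_{r/2},\dots,a_1,a_{ -1},\dots,a_{ -r/2})$ and the last row is $(a_{3r/2-1},\dots,a_r,a_{r-2},\dots,a_{r/2-1})$). Then for all $n\ge0$, $$\tilde F^{(r)}_n=\sum_{j=r/2}^{r-1}c_ja_{n+r-j}+\sum_{j=r}^{3r/2-1}c_ja_{n+r-j-1}.$$ (ii) If $r$ is odd, suppose $\mathbf c=(c_{(r-1)/2},c_{(r-1)/2+1},\dots,c_{3(r-1)/2})^T$ satisfies $A_o\mathbf c=\mathbf e_r$, where $A_o$ is the $r\times r$ Toeplitz matrix whose row indexed by $n=0,1,\dots,r-1$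 is $$\left(a_{n+(r-1)/2},a_{n+(r-1)/2-1},\dots,a_{n-(r-1)/2}\right).$$ Then for all $n\ge0$, $$\tilde F^{(r)}_n=\sum_{j=(r-1)/2}^{3(r-1)/2}c_ja_{n+r-j-1}.$$ (iii) If the block Toeplitz matrix $A_e$ (for even $r$), respectively the Toeplitz matrix $A_o$ (for odd $r$), is invertible, then the coefficient vector $\mathbf c$ in the corresponding expression exists and is unique.
   Context: The impulse response sequence (IRS) with respect to $\{p_1,\dots,p_r\}$ is the sequence $(\tilde F^{(r)}_n)_{n\ge0}$ with $\tilde F^{(r)}_n=\sum_{j=1}^rp_j\tilde F^{(r)}_{n-j}$ for $n\ge r$, $\tilde F^{(r)}_0=\dots=\tilde F^{(r)}_{r-2}=0$, $\tilde F^{(r)}_{r-1}=1$. -}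

module Defs where

open import Level using (_⊔_)
open import Algebra.Bundles using (CommutativeRing)
open import Data.Nat as ℕ using (ℕ; zero; suc; _∸_; _<_; _≤_; _<?_; ⌊_/2⌋; _≡ᵇ_)
open import Data.Integer as ℤ using (ℤ; +_)
open import Data.Fin using (Fin; toℕ; fromℕ<)
open import Data.Bool using (if_then_else_)
open import Data.Product using (_×_; Σ; ∃; ∃!)
open import Relation.Nullary using (yes; no)

module _ {c ℓ} (R : CommutativeRing c ℓ) where
  open CommutativeRing R

  sumLen : ℕ → (ℕ → Carrier) → Carrier
  sumLen zero    f = 0#
  sumLen (suc k) f = sumLen k f + f k

  -- Σ_{j=lo}^{hi} f j  (empty, i.e. 0, if hi < lo)
  sumFromTo : ℕ → ℕ → (ℕ → Carrier) → Carrier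
  sumFromTo lo hi f = sumLen (suc hi ∸ lo) (λ i → f (lo ℕ.+ i))

  sumFin : (n : ℕ) → (Fin n → Carrier) → Carrier
  sumFin zero    f = 0#
  sumFin (suc n) f = f Fin.zero + sumFin n (λ k → f (Fin.suc k))
    where import Data.Fin as Fin

  IsIRS : (r : ℕ) → (ℕ → Carrier) → (ℕ → Carrier) → Set ℓ
  IsIRS r p F =
    (∀ n → n < r ∸ 1 → F n ≈ 0#) ×
    (F (r ∸ 1) ≈ 1#) ×
    (∀ n → r ≤ n → F n ≈ sumFromTo 1 r (λ j → p j * F (n ∸ j)))

  SatisfiesRec : (r : ℕ) → (ℕ → Carrier) → (ℤ → Carrier) → Set ℓ
  SatisfiesRec r p a =
    ∀ (n : ℤ) → a n ≈ sumFromTo 1 r (λ j → p j * a (n ℤ.- + j))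

  Matrix : ℕ → Set c
  Matrix r = Fin r → Fin r → Carrier

  mulVec : (r : ℕ) → Matrix r → (Fin r → Carrier) → Fin r → Carrier
  mulVec r A x i = sumFin r (λ k → A i k * x k)

  mulMat : (r : ℕ) → Matrix r → Matrix r → Matrix r
  mulMat r A B i j = sumFin r (λ k → A i k * B k j)

  identity : (r : ℕ) → Matrix r
  identity r i j = if toℕ i ≡ᵇ toℕ j then 1# else 0#

  eLast : (r : ℕ) → Fin r → Carrier
  eLast r i = if toℕ i ≡ᵇ (r ∸ 1) then 1# else 0#

  MatEq : (r : ℕ) → Matrix r → Matrix r → Set ℓ
  MatEq r A B = ∀ i j → A i j ≈ B i j

  VecEq : (r : ℕ) → (Fin r → Carrier) → (Fin r → Carrier) → Set ℓ
  VecEq r x y = ∀ i → x i ≈ y i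

  Invertible : (r : ℕ) → Matrix r → Set (c ⊔ ℓ)
  Invertible r A = Σ (Matrix r) λ B → MatEq r (mulMat r A B) (identity r) × MatEq r (mulMat r B A) (identity r)

  UniqueSolution : (r : ℕ) → Matrix r → Set (c ⊔ ℓ)
  UniqueSolution r A = ∃! (VecEq r) (λ x → VecEq r (mulVec r A x) (eLast r))

  -- A_e (r even, m = r/2): row n = (a_{n+m}, …, a_{n+1}, a_{n-1}, …, a_{n-m}),
  -- column k (0-based): a_{n+m-k} for k < m, a_{n-1-(k-m)} for k ≥ m
  Ae : (r : ℕ) → (ℤ → Carrier) → Matrix r
  Ae r a n k with toℕ k <? ⌊ r /2⌋
  ... | yes _ = a (+ toℕ n ℤ.+ + ⌊ r /2⌋ ℤ.- + toℕ k)
  ... | no  _ = a (+ toℕ n ℤ.- + 1 ℤ.- (+ toℕ k ℤ.- + ⌊ r /2⌋))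

  -- A_o (r odd, m = (r-1)/2): row n = (a_{n+m}, a_{n+m-1}, …, a_{n-m})
  Ao : (r : ℕ) → (ℤ → Carrier) → Matrix r
  Ao r a n k = a (+ toℕ n ℤ.+ + ⌊ r /2⌋ ℤ.- + toℕ k)

  -- coefficient c_j of a vector c = (c_off, c_{off+1}, …, c_{off+r-1})^T ∈ Fin r → Carrier
  -- (0 outside that index range; never used there)
  coef : (r : ℕ) → ℕ → (Fin r → Carrier) → ℕ → Carrier
  coef r off cv j with j ∸ off <? r
  ... | yes p = cv (fromℕ< p)
  ... | no  _ = 0#

-- The columns of A_e (resp. A_o), read as functions of the row index n, are shifts
-- n ↦ a_{n+d} of a, so each satisfies the recurrence for n ≥ r, and hence so does
-- the linear combination G n = Σ_k c_k a_{n+d_k}. The system A c = e_r says that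
-- G agrees with the impulse response on 0, …, r-1, so the two sequences coincide.
-- The stated formulas are G rewritten in the paper's indexing j = ⌊r/2⌋ + k.
module Submission where

open import Defs
open import Algebra.Bundles using (CommutativeRing)
open import Data.Nat as ℕ using (ℕ; _≤_; _%_; ⌊_/2⌋)
open import Data.Integer as ℤ using (ℤ; +_)
open import Data.Fin using (Fin)
open import Data.Product using (_×_)
open import Relation.Binary.PropositionalEquality using (_≡_)
open import Relation.Nullary using (¬_)

open import Data.Nat using (zero; suc; _<_; _<?_; _∸_; _≡ᵇ_; z<s)
open import Data.Nat.Induction using (<-rec)
import Data.Nat.Properties as ℕₚ
import Data.Nat.Tactic.RingSolver as ℕ-Solver
import Data.Integer.Properties as ℤₚ
import Data.Integer.Tactic.RingSolver as ℤ-Solver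
open import Data.Fin using (toℕ; fromℕ<)
import Data.Fin as Fin using (zero; suc)
import Data.Fin.Properties as Finₚ
open import Data.Product using (_,_)
open import Data.Bool using (true; false; T)
open import Data.Unit using (tt)
import Relation.Binary.PropositionalEquality as ≡
open import Relation.Nullary using (yes; no; contradiction)

n%2≡0⇒n≡⌊n/2⌋+⌊n/2⌋ : ∀ n → n % 2 ≡ 0 → n ≡ ⌊ n /2⌋ ℕ.+ ⌊ n /2⌋
n%2≡0⇒n≡⌊n/2⌋+⌊n/2⌋ zero          _ = ≡.refl
n%2≡0⇒n≡⌊n/2⌋+⌊n/2⌋ (suc (suc n)) e =
  ≡.cong suc (≡.trans (≡.cong suc (n%2≡0⇒n≡⌊n/2⌋+⌊n/2⌋ n e)) (≡.sym (ℕₚ.+-suc ⌊ n /2⌋ ⌊ n /2⌋)))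

n%2≡1⇒n≡1+⌊n/2⌋+⌊n/2⌋ : ∀ n → n % 2 ≡ 1 → n ≡ suc (⌊ n /2⌋ ℕ.+ ⌊ n /2⌋)
n%2≡1⇒n≡1+⌊n/2⌋+⌊n/2⌋ (suc zero)    _ = ≡.refl
n%2≡1⇒n≡1+⌊n/2⌋+⌊n/2⌋ (suc (suc n)) e =
  ≡.cong (λ m → suc (suc m)) (≡.trans (n%2≡1⇒n≡1+⌊n/2⌋+⌊n/2⌋ n e) (≡.sym (ℕₚ.+-suc ⌊ n /2⌋ ⌊ n /2⌋)))

pos-∸ : ∀ {m n} → n ≤ m → + (m ∸ n) ≡ + m ℤ.- + n
pos-∸ {m} {n} n≤m = ≡.sym (≡.trans (ℤₚ.m-n≡m⊖n m n) (ℤₚ.⊖-≥ n≤m))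

+-∸-shift : ∀ {t j} (d : ℤ) → j ≤ t → + t ℤ.+ d ℤ.- + j ≡ + (t ∸ j) ℤ.+ d
+-∸-shift {t} {j} d j≤t = ≡.trans (ring (+ t) d (+ j)) (≡.cong (ℤ._+ d) (≡.sym (pos-∸ j≤t)))
  where
  ring : ∀ T D J → T ℤ.+ D ℤ.- J ≡ (T ℤ.- J) ℤ.+ D
  ring = ℤ-Solver.solve-∀

Ae-offset : ℕ → ℕ → ℤ
Ae-offset m k with k <? m
... | yes _ = + m ℤ.- + k
... | no  _ = ℤ.- + 1 ℤ.- (+ k ℤ.- + m)

Ao-offset : ℕ → ℕ → ℤ
Ao-offset m k = + m ℤ.- + k

Ae-offset-lower : ∀ n {m i} → i < m → + n ℤ.+ Ae-offset m i ≡ + n ℤ.+ + (m ℕ.+ m) ℤ.- + (m ℕ.+ i)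
Ae-offset-lower n {m} {i} i<m with i <? m
... | no  i≮m = contradiction i<m i≮m
... | yes _ rewrite ℤₚ.pos-+ m m | ℤₚ.pos-+ m i = ring (+ n) (+ m) (+ i)
  where
  ring : ∀ N M I → N ℤ.+ (M ℤ.- I) ≡ N ℤ.+ (M ℤ.+ M) ℤ.- (M ℤ.+ I)
  ring = ℤ-Solver.solve-∀

Ae-offset-upper : ∀ n m i →
  + n ℤ.+ Ae-offset m (m ℕ.+ i) ≡ + n ℤ.+ + (m ℕ.+ m) ℤ.- + (m ℕ.+ m ℕ.+ i) ℤ.- + 1
Ae-offset-upper n m i with m ℕ.+ i <? m
... | yes m+i<m = contradiction m+i<m (ℕₚ.m+n≮m m i)
... | no  _ rewrite ℤₚ.pos-+ m m | ℤₚ.pos-+ (m ℕ.+ m) i | ℤₚ.pos-+ m i =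
  ring (+ n) (+ m) (+ i)
  where
  ring : ∀ N M I → N ℤ.+ (ℤ.- + 1 ℤ.- ((M ℤ.+ I) ℤ.- M)) ≡ N ℤ.+ (M ℤ.+ M) ℤ.- ((M ℤ.+ M) ℤ.+ I) ℤ.- + 1
  ring = ℤ-Solver.solve-∀

Ao-offset-index : ∀ n m i → + n ℤ.+ Ao-offset m i ≡ + n ℤ.+ + suc (m ℕ.+ m) ℤ.- + (m ℕ.+ i) ℤ.- + 1
Ao-offset-index n m i rewrite ℤₚ.pos-+ 1 (m ℕ.+ m) | ℤₚ.pos-+ m m | ℤₚ.pos-+ m i = ring (+ n) (+ m) (+ i)
  where
  ring : ∀ N M I → N ℤ.+ (M ℤ.- I) ≡ N ℤ.+ (+ 1 ℤ.+ (M ℤ.+ M)) ℤ.- (M ℤ.+ I) ℤ.- + 1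
  ring = ℤ-Solver.solve-∀

suc[2m∸1]∸m≡m : ∀ m → 1 ≤ m → suc (m ℕ.+ m ∸ 1) ∸ m ≡ m
suc[2m∸1]∸m≡m (suc m) _ = ℕₚ.m+n∸m≡n m (suc m)

suc[3m∸1]∸2m≡m : ∀ m → 1 ≤ m → suc (3 ℕ.* m ∸ 1) ∸ (m ℕ.+ m) ≡ m
suc[3m∸1]∸2m≡m (suc m) _ =
  ≡.trans (≡.cong (_∸ (m ℕ.+ suc m)) (ring m)) (ℕₚ.m+n∸m≡n (m ℕ.+ suc m) (suc m))
  where
  ring : ∀ m → m ℕ.+ suc (m ℕ.+ suc (m ℕ.+ 0)) ≡ m ℕ.+ suc m ℕ.+ suc m
  ring = ℕ-Solver.solve-∀

suc[3m]∸m≡1+2m : ∀ m → suc (3 ℕ.* m) ∸ m ≡ suc (m ℕ.+ m)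
suc[3m]∸m≡1+2m m = ≡.trans (≡.cong (_∸ m) (ring m)) (ℕₚ.m+n∸m≡n m (suc (m ℕ.+ m)))
  where
  ring : ∀ m → suc (3 ℕ.* m) ≡ m ℕ.+ suc (m ℕ.+ m)
  ring = ℕ-Solver.solve-∀

module _ {c ℓ} (R : CommutativeRing c ℓ) where
  open CommutativeRing R
  open import Algebra.Properties.Semiring.Sum semiring
  open import Relation.Binary.Reasoning.Setoid setoid

  sumFin≡∑ : ∀ n (f : Fin n → Carrier) → sumFin R n f ≡ ∑[ k < n ] f k
  sumFin≡∑ zero    f = ≡.refl
  sumFin≡∑ (suc n) f = ≡.cong (λ s → f Fin.zero + s) (sumFin≡∑ n (λ k → f (Fin.suc k)))

  sumLen-cong : ∀ L {f g : ℕ → Carrier} → (∀ i → i < L → f i ≈ g i) → sumLen R L f ≈ sumLen R L g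
  sumLen-cong zero    f≈g = refl
  sumLen-cong (suc L) f≈g = +-cong (sumLen-cong L (λ i i<L → f≈g i (ℕₚ.m<n⇒m<1+n i<L))) (f≈g L ℕₚ.≤-refl)

  sumLen-reindex : ∀ {L L'} {f g : ℕ → Carrier} → L ≡ L' → (∀ i → i < L → f i ≈ g i) →
                   sumLen R L f ≈ sumLen R L' g
  sumLen-reindex {L} ≡.refl = sumLen-cong L

  sumLen-+ : ∀ A B (f : ℕ → Carrier) → sumLen R (A ℕ.+ B) f ≈ sumLen R A f + sumLen R B (λ i → f (A ℕ.+ i))
  sumLen-+ A zero    f rewrite ℕₚ.+-identityʳ A = sym (+-identityʳ _)
  sumLen-+ A (suc B) f rewrite ℕₚ.+-suc A B = trans (+-congʳ (sumLen-+ A B f)) (+-assoc _ _ _)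

  sumLen≈∑ : ∀ L (f : ℕ → Carrier) → sumLen R L f ≈ ∑[ i < L ] f (toℕ i)
  sumLen≈∑ zero    f = refl
  sumLen≈∑ (suc L) f = begin
    sumLen R L f + f L
      ≈⟨ +-cong (sumLen≈∑ L f) (reflexive (≡.cong f (≡.sym (Finₚ.toℕ-fromℕ L)))) ⟩
    ∑[ i < L ] f (toℕ i) + f (toℕ (fromℕ L))
      ≈⟨ +-congʳ (sum-cong-≋ {L} (λ i → reflexive (≡.cong f (≡.sym (Finₚ.toℕ-inject₁ i))))) ⟩
    ∑[ i < L ] f (toℕ (inject₁ i)) + f (toℕ (fromℕ L))
      ≈⟨ sym (sum-init-last {L} (λ i → f (toℕ i))) ⟩
    ∑[ i < suc L ] f (toℕ i) ∎
    where open import Data.Fin using (fromℕ; inject₁)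

  *-distribʳ-sumLen : ∀ x L (f : ℕ → Carrier) → sumLen R L f * x ≈ sumLen R L (λ i → f i * x)
  *-distribʳ-sumLen x zero    f = zeroˡ x
  *-distribʳ-sumLen x (suc L) f = trans (distribʳ _ _ _) (+-congʳ (*-distribʳ-sumLen x L f))

  ∑-sumLen-comm : ∀ n L (f : Fin n → ℕ → Carrier) →
                  ∑[ k < n ] sumLen R L (f k) ≈ sumLen R L (λ i → ∑[ k < n ] f k i)
  ∑-sumLen-comm n zero    f = sum-replicate-zero n
  ∑-sumLen-comm n (suc L) f =
    trans (∑-distrib-+ (λ k → sumLen R L (f k)) (λ k → f k L)) (+-congʳ (∑-sumLen-comm n L f))

  coef-+ : ∀ r off (cv : Fin r → Carrier) (k : Fin r) → coef R r off cv (off ℕ.+ toℕ k) ≡ cv k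
  coef-+ r off cv k with off ℕ.+ toℕ k ∸ off <? r
  ... | yes lt = ≡.cong cv (Finₚ.toℕ-injective (≡.trans (Finₚ.toℕ-fromℕ< lt) (ℕₚ.m+n∸m≡n off (toℕ k))))
  ... | no  ≮r = contradiction (≡.subst (_< r) (≡.sym (ℕₚ.m+n∸m≡n off (toℕ k))) (Finₚ.toℕ<n k)) ≮r

  ∑≈sumLen-coef : ∀ r off (cv : Fin r → Carrier) (g : ℕ → Carrier) →
                  ∑[ k < r ] (g (toℕ k) * cv k) ≈ sumLen R r (λ i → coef R r off cv (off ℕ.+ i) * g i)
  ∑≈sumLen-coef r off cv g = begin
    ∑[ k < r ] (g (toℕ k) * cv k)
      ≈⟨ sum-cong-≋ {r} (λ k → trans (*-comm _ _) (*-congʳ (reflexive (≡.sym (coef-+ r off cv k))))) ⟩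
    ∑[ k < r ] (coef R r off cv (off ℕ.+ toℕ k) * g (toℕ k))
      ≈⟨ sumLen≈∑ r _ ⟨
    sumLen R r (λ i → coef R r off cv (off ℕ.+ i) * g i) ∎

  Recurrent : ℕ → (ℕ → Carrier) → (ℕ → Carrier) → Set ℓ
  Recurrent r p u = ∀ n → r ≤ n → u n ≈ sumFromTo R 1 r (λ j → p j * u (n ∸ j))

  recurrent-unique : ∀ {r p u v} → Recurrent r p u → Recurrent r p v →
                     (∀ n → n < r → u n ≈ v n) → ∀ n → u n ≈ v n
  recurrent-unique {r} {p} {u} {v} u-rec v-rec u≈v = <-rec (λ n → u n ≈ v n) step
    where
    step : ∀ n → (∀ {m} → m < n → u m ≈ v m) → u n ≈ v n
    step n ih with n <? r
    ... | yes n<r = u≈v n n<r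
    ... | no  n≮r = begin
      u n                                         ≈⟨ u-rec n r≤n ⟩
      sumLen R r (λ i → p (suc i) * u (n ∸ suc i)) ≈⟨ sumLen-cong r (λ i i<r → *-congˡ (ih (earlier i<r))) ⟩
      sumLen R r (λ i → p (suc i) * v (n ∸ suc i)) ≈⟨ v-rec n r≤n ⟨
      v n                                         ∎
      where
      r≤n = ℕₚ.≮⇒≥ n≮r
      earlier : ∀ {i} → i < r → n ∸ suc i < n
      earlier i<r = ℕₚ.∸-monoʳ-< z<s (ℕₚ.≤-trans i<r r≤n)

  recurrent-∑ : ∀ {r p m} (u : Fin m → ℕ → Carrier) (cv : Fin m → Carrier) →
                (∀ k → Recurrent r p (u k)) → Recurrent r p (λ n → ∑[ k < m ] (u k n * cv k))
  recurrent-∑ {r} {p} {m} u cv u-rec n r≤n = begin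
    ∑[ k < m ] (u k n * cv k)
      ≈⟨ sum-cong-≋ {m} (λ k → *-congʳ (u-rec k n r≤n)) ⟩
    ∑[ k < m ] (sumLen R r (λ i → p (suc i) * u k (n ∸ suc i)) * cv k)
      ≈⟨ sum-cong-≋ {m} (λ k → *-distribʳ-sumLen (cv k) r _) ⟩
    ∑[ k < m ] sumLen R r (λ i → p (suc i) * u k (n ∸ suc i) * cv k)
      ≈⟨ ∑-sumLen-comm m r _ ⟩
    sumLen R r (λ i → ∑[ k < m ] (p (suc i) * u k (n ∸ suc i) * cv k))
      ≈⟨ sumLen-cong r (λ i _ →
           trans (sum-cong-≋ {m} (λ k → *-assoc _ _ _)) (sym (*-distribˡ-sum {m} _ _))) ⟩
    sumLen R r (λ i → p (suc i) * ∑[ k < m ] (u k (n ∸ suc i) * cv k)) ∎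

  recurrent-shift : ∀ {r p a} → SatisfiesRec R r p a → ∀ d → Recurrent r p (λ n → a (+ n ℤ.+ d))
  recurrent-shift {r} {p} {a} a-rec d n r≤n = trans (a-rec (+ n ℤ.+ d))
    (sumLen-cong r (λ i i<r → *-congˡ (reflexive (≡.cong a (+-∸-shift d (ℕₚ.≤-trans i<r r≤n))))))

  irs-initial : ∀ {r p F} → IsIRS R r p F → ∀ i → eLast R r i ≈ F (toℕ i)
  irs-initial {r} {F = F} (F≈0 , F≈1 , _) i with toℕ i ≡ᵇ (r ∸ 1) in eq
  ... | true  = sym (trans (reflexive (≡.cong F (ℕₚ.≡ᵇ⇒≡ (toℕ i) (r ∸ 1) (≡.subst T (≡.sym eq) tt)))) F≈1)
  ... | false = sym (F≈0 (toℕ i) (ℕₚ.≤∧≢⇒< (ℕₚ.<⇒≤pred (Finₚ.toℕ<n i))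
                  (λ i≡r-1 → ≡.subst T eq (ℕₚ.≡⇒≡ᵇ (toℕ i) (r ∸ 1) i≡r-1))))

  mulVec≡∑ : ∀ n (A : Matrix R n) x i → mulVec R n A x i ≡ ∑[ k < n ] (A i k * x k)
  mulVec≡∑ n A x i = sumFin≡∑ n (λ k → A i k * x k)

  irs≈∑columns : ∀ {r p F} (A : Matrix R r) (u : Fin r → ℕ → Carrier) (cv : Fin r → Carrier) →
                 IsIRS R r p F → (∀ k → Recurrent r p (u k)) → (∀ i k → A i k ≈ u k (toℕ i)) →
                 VecEq R r (mulVec R r A cv) (eLast R r) →
                 ∀ n → F n ≈ ∑[ k < r ] (u k n * cv k)
  irs≈∑columns {r} {p} {F} A u cv irs@(_ , _ , F-rec) u-rec A≈u A[cv]≈e =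
    recurrent-unique {p = p} F-rec (recurrent-∑ {p = p} u cv u-rec) initial
    where
    initial : ∀ n → n < r → F n ≈ ∑[ k < r ] (u k n * cv k)
    initial n n<r = begin
      F n                           ≡⟨ ≡.cong F (Finₚ.toℕ-fromℕ< n<r) ⟨
      F (toℕ i)                     ≈⟨ irs-initial {p = p} irs i ⟨
      eLast R r i                   ≈⟨ A[cv]≈e i ⟨
      mulVec R r A cv i             ≡⟨ mulVec≡∑ r A cv i ⟩
      ∑[ k < r ] (A i k * cv k)     ≈⟨ sum-cong-≋ {r} (λ k → *-congʳ (A≈u i k)) ⟩
      ∑[ k < r ] (u k (toℕ i) * cv k) ≡⟨ ≡.cong (λ t → ∑[ k < r ] (u k t * cv k)) (Finₚ.toℕ-fromℕ< n<r) ⟩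
      ∑[ k < r ] (u k n * cv k)     ∎
      where i = fromℕ< n<r

  mulVec-cong : ∀ n (A B : Matrix R n) x y → MatEq R n A B → VecEq R n x y →
                VecEq R n (mulVec R n A x) (mulVec R n B y)
  mulVec-cong n A B x y A≈B x≈y i = begin
    mulVec R n A x i          ≡⟨ mulVec≡∑ n A x i ⟩
    ∑[ k < n ] (A i k * x k)  ≈⟨ sum-cong-≋ {n} (λ k → *-cong (A≈B i k) (x≈y k)) ⟩
    ∑[ k < n ] (B i k * y k)  ≡⟨ mulVec≡∑ n B y i ⟨
    mulVec R n B y i          ∎

  mulVec-mulMat : ∀ n (A B : Matrix R n) x →
                  VecEq R n (mulVec R n A (mulVec R n B x)) (mulVec R n (mulMat R n A B) x)
  mulVec-mulMat n A B x i = begin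
    mulVec R n A (mulVec R n B x) i
      ≡⟨ mulVec≡∑ n A _ i ⟩
    ∑[ k < n ] (A i k * mulVec R n B x k)
      ≈⟨ sum-cong-≋ {n} (λ k → *-congˡ (reflexive (mulVec≡∑ n B x k))) ⟩
    ∑[ k < n ] (A i k * ∑[ l < n ] (B k l * x l))
      ≈⟨ sum-cong-≋ {n} (λ k →
           trans (*-distribˡ-sum {n} _ _) (sum-cong-≋ {n} (λ l → sym (*-assoc _ _ _)))) ⟩
    ∑[ k < n ] ∑[ l < n ] (A i k * B k l * x l)
      ≈⟨ ∑-comm {n} {n} _ ⟩
    ∑[ l < n ] ∑[ k < n ] (A i k * B k l * x l)
      ≈⟨ sum-cong-≋ {n} (λ l → sym (*-distribʳ-sum {n} _ _)) ⟩
    ∑[ l < n ] (∑[ k < n ] (A i k * B k l) * x l)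
      ≈⟨ sum-cong-≋ {n} (λ l → *-congʳ (reflexive (≡.sym (sumFin≡∑ n _)))) ⟩
    ∑[ l < n ] (mulMat R n A B i l * x l)
      ≡⟨ mulVec≡∑ n (mulMat R n A B) x i ⟨
    mulVec R n (mulMat R n A B) x i ∎

  mulVec-identity : ∀ n x → VecEq R n (mulVec R n (identity R n) x) x
  mulVec-identity (suc n) x Fin.zero = trans (+-cong (*-identityˡ _) (begin
    sumFin R n (λ k → 0# * x (Fin.suc k)) ≡⟨ sumFin≡∑ n _ ⟩
    ∑[ k < n ] (0# * x (Fin.suc k))       ≈⟨ sum-cong-≋ {n} (λ k → zeroˡ _) ⟩
    ∑[ k < n ] 0#                          ≈⟨ sum-replicate-zero n ⟩
    0#                                     ∎)) (+-identityʳ _)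
  mulVec-identity (suc n) x (Fin.suc i) =
    trans (+-cong (zeroˡ _) (mulVec-identity n (λ k → x (Fin.suc k)) i)) (+-identityˡ _)

  invertible⇒uniqueSolution : ∀ n (A : Matrix R n) → Invertible R n A → UniqueSolution R n A
  invertible⇒uniqueSolution n A (B , AB≈I , BA≈I) = x , Ax≈e , unique
    where
    x = mulVec R n B (eLast R n)
    Ax≈e : VecEq R n (mulVec R n A x) (eLast R n)
    Ax≈e i = begin
      mulVec R n A x i                          ≈⟨ mulVec-mulMat n A B _ i ⟩
      mulVec R n (mulMat R n A B) (eLast R n) i ≈⟨ mulVec-cong n _ (identity R n) _ (eLast R n) AB≈I (λ _ → refl) i ⟩
      mulVec R n (identity R n) (eLast R n) i   ≈⟨ mulVec-identity n _ i ⟩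
      eLast R n i                               ∎
    unique : ∀ {y} → VecEq R n (mulVec R n A y) (eLast R n) → VecEq R n x y
    unique {y} Ay≈e i = begin
      x i                                ≈⟨ mulVec-cong n B B _ (eLast R n) (λ _ _ → refl) Ay≈e i ⟨
      mulVec R n B (mulVec R n A y) i    ≈⟨ mulVec-mulMat n B A y i ⟩
      mulVec R n (mulMat R n B A) y i    ≈⟨ mulVec-cong n _ (identity R n) y y BA≈I (λ _ → refl) i ⟩
      mulVec R n (identity R n) y i      ≈⟨ mulVec-identity n y i ⟩
      y i                                ∎

  Ae-column : ∀ r (a : ℤ → Carrier) i k → Ae R r a i k ≡ a (+ toℕ i ℤ.+ Ae-offset ⌊ r /2⌋ (toℕ k))
  Ae-column r a i k with toℕ k <? ⌊ r /2⌋
  ... | yes _ = ≡.cong a (ℤₚ.+-assoc (+ toℕ i) (+ ⌊ r /2⌋) (ℤ.- + toℕ k))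
  ... | no  _ = ≡.cong a (ℤₚ.+-assoc (+ toℕ i) (ℤ.- + 1) (ℤ.- (+ toℕ k ℤ.- + ⌊ r /2⌋)))

  Ao-column : ∀ r (a : ℤ → Carrier) i k → Ao R r a i k ≡ a (+ toℕ i ℤ.+ Ao-offset ⌊ r /2⌋ (toℕ k))
  Ao-column r a i k = ≡.cong a (ℤₚ.+-assoc (+ toℕ i) (+ ⌊ r /2⌋) (ℤ.- + toℕ k))

  ∑Ae-columns≈ : ∀ m r → r ≡ m ℕ.+ m → 1 ≤ m → (a : ℤ → Carrier) (cv : Fin r → Carrier) (n : ℕ) →
    ∑[ k < r ] (a (+ n ℤ.+ Ae-offset m (toℕ k)) * cv k) ≈
      sumFromTo R m (r ∸ 1) (λ j → coef R r m cv j * a (+ n ℤ.+ + r ℤ.- + j))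
      + sumFromTo R r (3 ℕ.* m ∸ 1) (λ j → coef R r m cv j * a (+ n ℤ.+ + r ℤ.- + j ℤ.- + 1))
  ∑Ae-columns≈ m _ ≡.refl m≥1 a cv n = begin
    ∑[ k < m ℕ.+ m ] (g (toℕ k) * cv k)       ≈⟨ ∑≈sumLen-coef (m ℕ.+ m) m cv g ⟩
    sumLen R (m ℕ.+ m) h                      ≈⟨ sumLen-+ m m h ⟩
    sumLen R m h + sumLen R m (λ i → h (m ℕ.+ i))
      ≈⟨ +-cong (sumLen-reindex (≡.sym (suc[2m∸1]∸m≡m m m≥1)) lower)
                (sumLen-reindex (≡.sym (suc[3m∸1]∸2m≡m m m≥1)) upper) ⟩
    _ ∎
    where
    g : ℕ → Carrier
    g t = a (+ n ℤ.+ Ae-offset m t)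
    h : ℕ → Carrier
    h i = coef R (m ℕ.+ m) m cv (m ℕ.+ i) * g i
    lower : ∀ i → i < m → h i ≈ coef R (m ℕ.+ m) m cv (m ℕ.+ i) * a (+ n ℤ.+ + (m ℕ.+ m) ℤ.- + (m ℕ.+ i))
    lower i i<m = *-congˡ (reflexive (≡.cong a (Ae-offset-lower n i<m)))
    upper : ∀ i → i < m → h (m ℕ.+ i) ≈
      coef R (m ℕ.+ m) m cv (m ℕ.+ m ℕ.+ i) * a (+ n ℤ.+ + (m ℕ.+ m) ℤ.- + (m ℕ.+ m ℕ.+ i) ℤ.- + 1)
    upper i _ = *-cong (reflexive (≡.cong (coef R (m ℕ.+ m) m cv) (≡.sym (ℕₚ.+-assoc m m i))))
                       (reflexive (≡.cong a (Ae-offset-upper n m i)))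

  ∑Ao-columns≈ : ∀ m r → r ≡ suc (m ℕ.+ m) → (a : ℤ → Carrier) (cv : Fin r → Carrier) (n : ℕ) →
    ∑[ k < r ] (a (+ n ℤ.+ Ao-offset m (toℕ k)) * cv k) ≈
      sumFromTo R m (3 ℕ.* m) (λ j → coef R r m cv j * a (+ n ℤ.+ + r ℤ.- + j ℤ.- + 1))
  ∑Ao-columns≈ m _ ≡.refl a cv n =
    trans (∑≈sumLen-coef _ m cv (λ t → a (+ n ℤ.+ Ao-offset m t)))
          (sumLen-reindex (≡.sym (suc[3m]∸m≡1+2m m))
            (λ i _ → *-congˡ (reflexive (≡.cong a (Ao-offset-index n m i)))))

  irs-even : ∀ {r p F a} → 2 ≤ r → r % 2 ≡ 0 → IsIRS R r p F → SatisfiesRec R r p a →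
    (cv : Fin r → Carrier) → VecEq R r (mulVec R r (Ae R r a) cv) (eLast R r) →
    ∀ n → F n ≈
      sumFromTo R ⌊ r /2⌋ (r ∸ 1) (λ j → coef R r ⌊ r /2⌋ cv j * a (+ n ℤ.+ + r ℤ.- + j))
      + sumFromTo R r (3 ℕ.* ⌊ r /2⌋ ∸ 1) (λ j → coef R r ⌊ r /2⌋ cv j * a (+ n ℤ.+ + r ℤ.- + j ℤ.- + 1))
  irs-even {r} {p} {a = a} r≥2 even irs a-rec cv A[cv]≈e n = begin
    _ ≈⟨ irs≈∑columns {p = p} (Ae R r a) column cv irs (λ k → recurrent-shift {p = p} a-rec (offset k))
                      (λ i k → reflexive (Ae-column r a i k)) A[cv]≈e n ⟩
    _ ≈⟨ ∑Ae-columns≈ ⌊ r /2⌋ r (n%2≡0⇒n≡⌊n/2⌋+⌊n/2⌋ r even) (ℕₚ.⌊n/2⌋-mono r≥2) a cv n ⟩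
    _ ∎
    where
    offset : Fin r → ℤ
    offset k = Ae-offset ⌊ r /2⌋ (toℕ k)
    column : Fin r → ℕ → Carrier
    column k t = a (+ t ℤ.+ offset k)

  irs-odd : ∀ {r p F a} → r % 2 ≡ 1 → IsIRS R r p F → SatisfiesRec R r p a →
    (cv : Fin r → Carrier) → VecEq R r (mulVec R r (Ao R r a) cv) (eLast R r) →
    ∀ n → F n ≈ sumFromTo R ⌊ r /2⌋ (3 ℕ.* ⌊ r /2⌋) (λ j → coef R r ⌊ r /2⌋ cv j * a (+ n ℤ.+ + r ℤ.- + j ℤ.- + 1))
  irs-odd {r} {p} {a = a} odd irs a-rec cv A[cv]≈e n = begin
    _ ≈⟨ irs≈∑columns {p = p} (Ao R r a) column cv irs (λ k → recurrent-shift {p = p} a-rec (offset k))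
                      (λ i k → reflexive (Ao-column r a i k)) A[cv]≈e n ⟩
    _ ≈⟨ ∑Ao-columns≈ ⌊ r /2⌋ r (n%2≡1⇒n≡1+⌊n/2⌋+⌊n/2⌋ r odd) a cv n ⟩
    _ ∎
    where
    offset : Fin r → ℤ
    offset k = Ao-offset ⌊ r /2⌋ (toℕ k)
    column : Fin r → ℕ → Carrier
    column k t = a (+ t ℤ.+ offset k)

theorem2p5 : ∀ {c ℓ} (R : CommutativeRing c ℓ) → let open CommutativeRing R in
    (r : ℕ) → 2 ≤ r →
    (p : ℕ → Carrier) → ¬ (p r ≈ 0#) →
    (F : ℕ → Carrier) → IsIRS R r p F →
    (a : ℤ → Carrier) → SatisfiesRec R r p a →
    (r % 2 ≡ 0 →
      (cv : Fin r → Carrier) → VecEq R r (mulVec R r (Ae R r a) cv) (eLast R r) →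
      ∀ (n : ℕ) → F n ≈
        sumFromTo R ⌊ r /2⌋ (r ℕ.∸ 1)
          (λ j → coef R r ⌊ r /2⌋ cv j * a (+ n ℤ.+ + r ℤ.- + j))
        + sumFromTo R r (3 ℕ.* ⌊ r /2⌋ ℕ.∸ 1)
          (λ j → coef R r ⌊ r /2⌋ cv j * a (+ n ℤ.+ + r ℤ.- + j ℤ.- + 1)))
    ×
    (r % 2 ≡ 1 →
      (cv : Fin r → Carrier) → VecEq R r (mulVec R r (Ao R r a) cv) (eLast R r) →
      ∀ (n : ℕ) → F n ≈
        sumFromTo R ⌊ r /2⌋ (3 ℕ.* ⌊ r /2⌋)
          (λ j → coef R r ⌊ r /2⌋ cv j * a (+ n ℤ.+ + r ℤ.- + j ℤ.- + 1)))
    ×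
    (r % 2 ≡ 0 → Invertible R r (Ae R r a) → UniqueSolution R r (Ae R r a))
    ×
    (r % 2 ≡ 1 → Invertible R r (Ao R r a) → UniqueSolution R r (Ao R r a))
theorem2p5 R r r≥2 p _ F irs a a-rec =
  (λ even → irs-even R {p = p} r≥2 even irs a-rec) ,
  (λ odd → irs-odd R {p = p} odd irs a-rec) ,
  (λ _ → invertible⇒uniqueSolution R r (Ae R r a)) ,
  (λ _ → invertible⇒uniqueSolution R r (Ao R r a))
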